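{- Let $m\ge 1$ be an integer and let $n,i$ be non-negative integers with $i\le n$. Then for every integer $t$, \[ \sum_{k=0}^{n}R_{n,k}^{(m)}(t)\,D_{m}(i+k,t)\equiv 0 \pmod{n!}. \]
   Context: For a positive integer $m$, $W_{m}(n,k)=\frac{1}{m^{k}k!}\sum_{i=0}^{k}\binom{k}{i}(-1)^{k-i}(mi+1)^{n}$ are the Whitney numbers of the second kind of Dowling lattices, and the Dowling polynomials are $D_m(n,t)=\sum_{k=0}^{n}W_m(n,k)t^k$. The polynomials $R_{n,k}^{(m)}(t)$ are defined by $\sum_{n\ge k}R_{n,k}^{(m)}(t)\frac{z^n}{n!}=e^{ -tz}(1+mz)^{ -1/m}\frac{(\ln(1+mz))^k}{m^k k!}$. -}

module Defs where

open import Data.Nat as ℕ using (ℕ; zero; suc; NonZero; _!)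
open import Data.Nat.Properties using (m^n≢0; m*n≢0; _!≢0)
open import Data.Nat.Combinatorics using (_C_)
open import Data.Integer as ℤ using (ℤ; +_)
open import Data.Rational as ℚ using (ℚ; _/_)

sumℤ : ℕ → (ℕ → ℤ) → ℤ
sumℤ zero    f = f zero
sumℤ (suc n) f = sumℤ n f ℤ.+ f (suc n)

sumℚ : ℕ → (ℕ → ℚ) → ℚ
sumℚ zero    f = f zero
sumℚ (suc n) f = sumℚ n f ℚ.+ f (suc n)

ι : ℤ → ℚ
ι z = z / 1

sgn : ℕ → ℤ
sgn zero    = + 1
sgn (suc j) = ℤ.- sgn j

W : (m : ℕ) → .{{NonZero m}} → ℕ → ℕ → ℚ
W m n k =
  (sumℤ k (λ i → ((+ (k C i)) ℤ.* sgn (k ℕ.∸ i)) ℤ.* ((+ (m ℕ.* i ℕ.+ 1)) ℤ.^ n)))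
    / (m ℕ.^ k ℕ.* k !)
  where instance
    _ = m^n≢0 m k
    _ = k !≢0
    _ = m*n≢0 (m ℕ.^ k) (k !)

D : (m : ℕ) → .{{NonZero m}} → ℕ → ℤ → ℚ
D m n t = sumℚ n (λ k → W m n k ℚ.* ι (t ℤ.^ k))

-- R^{(m)}_{n,k}(t), defined by
--   Σ_{n≥k} R_{n,k}(t) z^n/n! = e^{-tz} (1+mz)^{-1/m} (ln(1+mz))^k / (m^k k!).
-- We take n!·[z^n] of the product of the three exponential generating
-- functions (binomial convolution of their EGF coefficients):
--   e^{-tz}            = Σ_j (-t)^j z^j/j!
--   (1+mz)^{-1/m}      = Σ_j b_j z^j/j!,  b_0 = 1, b_{j+1} = -(1 + m j) b_j
--                        (equivalently (1+mz) B'(z) = -B(z), B(0)=1)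
--   (ln(1+mz))^k/(m^k k!) = Σ_n c_{n,k} z^n/n!, where c_{0,0}=1, c_{0,k+1}=0,
--                        c_{n+1,0}=0, c_{n+1,k+1} = c_{n,k} - m n c_{n,k+1}
--                        (equivalently (1+mz) C_k'(z) = C_{k-1}(z), C_k(0)=[k=0]),
--                        i.e. c_{n,k} = m^{n-k} s(n,k) with s signed Stirling numbers of the first kind.

bcoef : ℕ → ℕ → ℤ
bcoef m zero    = + 1
bcoef m (suc j) = ℤ.- ((+ (1 ℕ.+ m ℕ.* j)) ℤ.* bcoef m j)

ccoef : ℕ → ℕ → ℕ → ℤ
ccoef m zero    zero    = + 1
ccoef m zero    (suc k) = + 0
ccoef m (suc n) zero    = + 0
ccoef m (suc n) (suc k) = ccoef m n k ℤ.- ((+ (m ℕ.* n)) ℤ.* ccoef m n (suc k))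

R : ℕ → ℕ → ℕ → ℤ → ℤ
R m n k t =
  sumℤ n (λ j → (+ (n C j)) ℤ.* ((ℤ.- t) ℤ.^ (n ℕ.∸ j)) ℤ.*
    sumℤ j (λ l → (+ (j C l)) ℤ.* bcoef m (j ℕ.∸ l) ℤ.* ccoef m l k))

{-# OPTIONS --safe #-}
-- Over ℤ, the rows of W_m are the iterates of  step f r = f (r - 1) + (1 + m r) f r  on the
-- unit sequence at 0, and R_{n,k}(t) = Σ_j C(n,j) (-t)^{n-j} w(j,k), where w(j,k), the
-- coefficients of (1+mz)^{-1/m} (ln(1+mz))^k / (m^k k!), are the Whitney numbers of the first
-- kind, whose matrix is inverse to that of W_m.  Orthogonality turns Σ_k w(j,k) D_m(i+k,t) into
-- t^j Σ_p C(i,p) (mj)^{i-p} D_m(p,t), so the whole sum equals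
--   t^n Σ_p C(i,p) m^{i-p} D_m(p,t) Δⁿ[j ↦ j^{i-p}]
-- with Δⁿ the n-th forward difference at 0; as i - p ≤ n, each Δⁿ[j ↦ j^{i-p}] is 0 or n!.
module Submission where

open import Defs
open import Data.Nat as ℕ using (ℕ; zero; suc; NonZero; _≤_; _<_; _!; z≤n; s≤s)
import Data.Nat.Properties as ℕP
open import Data.Nat.Combinatorics using (_C_; nCk+nC[k+1]≡[n+1]C[k+1]; k>n⇒nCk≡0; nCn≡1; nC1≡n; nCk≡nC[n∸k])
open import Data.Integer.Divisibility.Signed using (_∣_; divides; quotient; ∣-reflexive; ∣m∣n⇒∣m+n; ∣n⇒∣m*n)
open import Data.Integer as ℤ using (ℤ; +_; _+_; _*_; -_; _-_; _^_)
import Data.Integer.Properties as ℤP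
open import Data.Integer.Tactic.RingSolver using (solve-∀)
import Data.Nat.Tactic.RingSolver as ℕS
open import Data.Rational as ℚ using (ℚ)
import Data.Rational.Properties as ℚP
open import Data.Rational.Unnormalised as ℚᵘ using (mkℚᵘ; *≡*)
import Data.Rational.Unnormalised.Properties as ℚᵘP
open import Data.Product using (∃; _,_)
open import Data.Sum using (inj₁; inj₂)
open import Relation.Binary.PropositionalEquality
open ≡-Reasoning

sum-cong : ∀ n {f g : ℕ → ℤ} → (∀ i → i ≤ n → f i ≡ g i) → sumℤ n f ≡ sumℤ n g
sum-cong zero    f≡g = f≡g 0 z≤n
sum-cong (suc n) f≡g = cong₂ _+_ (sum-cong n (λ i i≤n → f≡g i (ℕP.m≤n⇒m≤1+n i≤n))) (f≡g (suc n) ℕP.≤-refl)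

sum-zero : ∀ n {f : ℕ → ℤ} → (∀ i → i ≤ n → f i ≡ + 0) → sumℤ n f ≡ + 0
sum-zero zero    f≡0 = f≡0 0 z≤n
sum-zero (suc n) f≡0 = cong₂ _+_ (sum-zero n (λ i i≤n → f≡0 i (ℕP.m≤n⇒m≤1+n i≤n))) (f≡0 (suc n) ℕP.≤-refl)

sum-+ : ∀ n (f g : ℕ → ℤ) → sumℤ n (λ i → f i + g i) ≡ sumℤ n f + sumℤ n g
sum-+ zero    f g = refl
sum-+ (suc n) f g =
  trans (cong (_+ (f (suc n) + g (suc n))) (sum-+ n f g)) (swap-middle (sumℤ n f) (sumℤ n g) (f (suc n)) (g (suc n)))
  where
  swap-middle : ∀ a b c d → a + b + (c + d) ≡ a + c + (b + d)
  swap-middle = solve-∀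

sum-*ˡ : ∀ n c (f : ℕ → ℤ) → sumℤ n (λ i → c * f i) ≡ c * sumℤ n f
sum-*ˡ zero    c f = refl
sum-*ˡ (suc n) c f =
  trans (cong (_+ c * f (suc n)) (sum-*ˡ n c f)) (sym (ℤP.*-distribˡ-+ c (sumℤ n f) (f (suc n))))

sum-*ʳ : ∀ n c (f : ℕ → ℤ) → sumℤ n (λ i → f i * c) ≡ sumℤ n f * c
sum-*ʳ n c f = begin
  sumℤ n (λ i → f i * c) ≡⟨ sum-cong n (λ i _ → ℤP.*-comm (f i) c) ⟩
  sumℤ n (λ i → c * f i) ≡⟨ sum-*ˡ n c f ⟩
  c * sumℤ n f           ≡⟨ ℤP.*-comm c _ ⟩
  sumℤ n f * c           ∎

sum-minus : ∀ n (f g : ℕ → ℤ) → sumℤ n (λ i → f i - g i) ≡ sumℤ n f - sumℤ n g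
sum-minus zero    f g = refl
sum-minus (suc n) f g =
  trans (cong (_+ (f (suc n) - g (suc n))) (sum-minus n f g)) (regroup (sumℤ n f) (sumℤ n g) (f (suc n)) (g (suc n)))
  where
  regroup : ∀ a b c d → a - b + (c - d) ≡ a + c - (b + d)
  regroup = solve-∀

sum-swap : ∀ a b (f : ℕ → ℕ → ℤ) →
  sumℤ a (λ i → sumℤ b (λ j → f i j)) ≡ sumℤ b (λ j → sumℤ a (λ i → f i j))
sum-swap zero    b f = refl
sum-swap (suc a) b f =
  trans (cong (_+ sumℤ b (f (suc a))) (sum-swap a b f)) (sym (sum-+ b _ (f (suc a))))

sum-suc : ∀ n (f : ℕ → ℤ) → sumℤ (suc n) f ≡ f 0 + sumℤ n (λ i → f (suc i))
sum-suc zero    f = refl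
sum-suc (suc n) f =
  trans (cong (_+ f (suc (suc n))) (sum-suc n f)) (ℤP.+-assoc (f 0) _ _)

sum-last : ∀ n {f : ℕ → ℤ} → (∀ i → i < n → f i ≡ + 0) → sumℤ n f ≡ f n
sum-last zero    f≡0 = refl
sum-last (suc n) {f} f≡0 =
  trans (cong (_+ f (suc n)) (sum-zero n (λ i i≤n → f≡0 i (s≤s i≤n)))) (ℤP.+-identityˡ _)

sum-extend : ∀ n N {f : ℕ → ℤ} → n ≤ N → (∀ i → n < i → i ≤ N → f i ≡ + 0) → sumℤ N f ≡ sumℤ n f
sum-extend n zero    z≤n       f≡0 = refl
sum-extend n (suc N) {f} n≤1+N f≡0 with ℕP.m≤n⇒m<n∨m≡n n≤1+N
... | inj₂ refl = refl
... | inj₁ (s≤s n≤N) = begin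
  sumℤ N f + f (suc N) ≡⟨ cong₂ _+_ (sum-extend n N n≤N (λ i n<i i≤N → f≡0 i n<i (ℕP.m≤n⇒m≤1+n i≤N)))
                                     (f≡0 (suc N) (s≤s n≤N) ℕP.≤-refl) ⟩
  sumℤ n f + + 0       ≡⟨ ℤP.+-identityʳ _ ⟩
  sumℤ n f             ∎

sum-drop : ∀ j Q {f : ℕ → ℤ} → (∀ r → r < j → f r ≡ + 0) →
  sumℤ (j ℕ.+ Q) f ≡ sumℤ Q (λ q → f (j ℕ.+ q))
sum-drop zero    Q f≡0 = refl
sum-drop (suc j) Q {f} f≡0 = begin
  sumℤ (suc (j ℕ.+ Q)) f                   ≡⟨ sum-suc (j ℕ.+ Q) f ⟩
  f 0 + sumℤ (j ℕ.+ Q) (λ r → f (suc r))   ≡⟨ cong₂ _+_ (f≡0 0 (s≤s z≤n)) (sum-drop j Q (λ r r<j → f≡0 (suc r) (s≤s r<j))) ⟩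
  + 0 + sumℤ Q (λ q → f (suc j ℕ.+ q))     ≡⟨ ℤP.+-identityˡ _ ⟩
  sumℤ Q (λ q → f (suc j ℕ.+ q))           ∎

∣-sumℤ : ∀ n {d : ℤ} {f : ℕ → ℤ} → (∀ i → i ≤ n → d ∣ f i) → d ∣ sumℤ n f
∣-sumℤ zero    d∣f = d∣f 0 z≤n
∣-sumℤ (suc n) d∣f = ∣m∣n⇒∣m+n (∣-sumℤ n (λ i i≤n → d∣f i (ℕP.m≤n⇒m≤1+n i≤n))) (d∣f (suc n) ℕP.≤-refl)

^-distribʳ-* : ∀ a b e → (a * b) ^ e ≡ a ^ e * b ^ e
^-distribʳ-* a b zero    = refl
^-distribʳ-* a b (suc e) = trans (cong ((a * b) *_) (^-distribʳ-* a b e)) (interchange a b (a ^ e) (b ^ e))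
  where
  interchange : ∀ a b x y → (a * b) * (x * y) ≡ (a * x) * (b * y)
  interchange = solve-∀

neg-^ : ∀ t e → (- t) ^ e ≡ sgn e * t ^ e
neg-^ t zero    = refl
neg-^ t (suc e) = trans (cong ((- t) *_) (neg-^ t e)) (move-sign t (sgn e) (t ^ e))
  where
  move-sign : ∀ t s x → (- t) * (s * x) ≡ (- s) * (t * x)
  move-sign = solve-∀

neg-^-complement : ∀ t {n j} → j ≤ n → (- t) ^ (n ℕ.∸ j) * t ^ j ≡ sgn (n ℕ.∸ j) * t ^ n
neg-^-complement t {n} {j} j≤n = begin
  (- t) ^ (n ℕ.∸ j) * t ^ j               ≡⟨ cong (_* t ^ j) (neg-^ t (n ℕ.∸ j)) ⟩
  sgn (n ℕ.∸ j) * t ^ (n ℕ.∸ j) * t ^ j    ≡⟨ ℤP.*-assoc (sgn (n ℕ.∸ j)) (t ^ (n ℕ.∸ j)) (t ^ j) ⟩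
  sgn (n ℕ.∸ j) * (t ^ (n ℕ.∸ j) * t ^ j)  ≡⟨ cong (sgn (n ℕ.∸ j) *_) (sym (ℤP.^-distribˡ-+-* t (n ℕ.∸ j) j)) ⟩
  sgn (n ℕ.∸ j) * t ^ (n ℕ.∸ j ℕ.+ j)     ≡⟨ cong (λ e → sgn (n ℕ.∸ j) * t ^ e) (ℕP.m∸n+n≡m j≤n) ⟩
  sgn (n ℕ.∸ j) * t ^ n                    ∎

C-suc : ∀ n k → suc n C suc k ≡ n C k ℕ.+ n C suc k
C-suc n k = sym (nCk+nC[k+1]≡[n+1]C[k+1] n k)

C-absorb : ∀ k i → suc i ℕ.* (suc k C suc i) ≡ suc k ℕ.* (k C i)
C-absorb zero    zero    = refl
C-absorb zero    (suc i) = trans (cong (suc (suc i) ℕ.*_) (k>n⇒nCk≡0 (s≤s (s≤s (z≤n {i}))))) (ℕP.*-zeroʳ (suc (suc i)))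
C-absorb (suc k) zero    =
  trans (ℕP.*-identityˡ (suc (suc k) C 1)) (trans (nC1≡n (suc (suc k))) (sym (ℕP.*-identityʳ (suc (suc k)))))
C-absorb (suc k) (suc i) = begin
  suc (suc i) ℕ.* (suc (suc k) C suc (suc i))             ≡⟨ cong (suc (suc i) ℕ.*_) (C-suc (suc k) (suc i)) ⟩
  suc (suc i) ℕ.* (X ℕ.+ Y)                               ≡⟨ ℕP.*-distribˡ-+ (suc (suc i)) X Y ⟩
  X ℕ.+ suc i ℕ.* X ℕ.+ suc (suc i) ℕ.* Y                 ≡⟨ cong₂ (λ a b → X ℕ.+ a ℕ.+ b) (C-absorb k i) (C-absorb k (suc i)) ⟩
  X ℕ.+ suc k ℕ.* (k C i) ℕ.+ suc k ℕ.* (k C suc i)       ≡⟨ ℕP.+-assoc X _ _ ⟩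
  X ℕ.+ (suc k ℕ.* (k C i) ℕ.+ suc k ℕ.* (k C suc i))     ≡⟨ cong (X ℕ.+_) (sym (ℕP.*-distribˡ-+ (suc k) (k C i) (k C suc i))) ⟩
  X ℕ.+ suc k ℕ.* (k C i ℕ.+ k C suc i)                   ≡⟨ cong (λ c → X ℕ.+ suc k ℕ.* c) (sym (C-suc k i)) ⟩
  suc (suc k) ℕ.* X                                       ∎
  where
  X = suc k C suc i
  Y = suc k C suc (suc i)

sum-pascal : ∀ j (F : ℕ → ℤ) →
  sumℤ (suc j) (λ l → + (suc j C l) * F l) ≡
  sumℤ j (λ l → + (j C l) * F l) + sumℤ j (λ l → + (j C l) * F (suc l))
sum-pascal j F = begin
  sumℤ (suc j) (λ l → + (suc j C l) * F l)
    ≡⟨ sum-suc j _ ⟩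
  + 1 * F 0 + sumℤ j (λ l → + (suc j C suc l) * F (suc l))
    ≡⟨ cong (λ x → + 1 * F 0 + x) (sum-cong j (λ l _ → split l)) ⟩
  + 1 * F 0 + sumℤ j (λ l → + (j C suc l) * F (suc l) + + (j C l) * F (suc l))
    ≡⟨ cong (λ x → + 1 * F 0 + x) (sum-+ j _ _) ⟩
  + 1 * F 0 + (sumℤ j (λ l → + (j C suc l) * F (suc l)) + sumℤ j (λ l → + (j C l) * F (suc l)))
    ≡⟨ sym (ℤP.+-assoc (+ 1 * F 0) _ _) ⟩
  + 1 * F 0 + sumℤ j (λ l → + (j C suc l) * F (suc l)) + sumℤ j (λ l → + (j C l) * F (suc l))
    ≡⟨ cong (_+ sumℤ j (λ l → + (j C l) * F (suc l))) (sym (sum-suc j _)) ⟩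
  sumℤ (suc j) (λ l → + (j C l) * F l) + sumℤ j (λ l → + (j C l) * F (suc l))
    ≡⟨ cong (_+ sumℤ j (λ l → + (j C l) * F (suc l))) drop-last ⟩
  sumℤ j (λ l → + (j C l) * F l) + sumℤ j (λ l → + (j C l) * F (suc l)) ∎
  where
  split : ∀ l → + (suc j C suc l) * F (suc l) ≡ + (j C suc l) * F (suc l) + + (j C l) * F (suc l)
  split l = begin
    + (suc j C suc l) * F (suc l)              ≡⟨ cong (λ c → + c * F (suc l)) (trans (C-suc j l) (ℕP.+-comm (j C l) _)) ⟩
    + (j C suc l ℕ.+ j C l) * F (suc l)        ≡⟨ cong (_* F (suc l)) (ℤP.pos-+ (j C suc l) (j C l)) ⟩
    (+ (j C suc l) + + (j C l)) * F (suc l)    ≡⟨ ℤP.*-distribʳ-+ (F (suc l)) (+ (j C suc l)) (+ (j C l)) ⟩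
    + (j C suc l) * F (suc l) + + (j C l) * F (suc l) ∎
  drop-last : sumℤ (suc j) (λ l → + (j C l) * F l) ≡ sumℤ j (λ l → + (j C l) * F l)
  drop-last = sum-extend j (suc j) (ℕP.n≤1+n j)
    (λ l j<l _ → trans (cong (λ c → + c * F l) (k>n⇒nCk≡0 j<l)) (ℤP.*-zeroˡ (F l)))

binomial : ∀ e (y : ℤ) → (+ 1 + y) ^ e ≡ sumℤ e (λ u → + (e C u) * y ^ u)
binomial zero    y = refl
binomial (suc e) y = begin
  (+ 1 + y) * (+ 1 + y) ^ e  ≡⟨ cong ((+ 1 + y) *_) (binomial e y) ⟩
  (+ 1 + y) * S              ≡⟨ ℤP.*-distribʳ-+ S (+ 1) y ⟩
  + 1 * S + y * S            ≡⟨ cong₂ _+_ (ℤP.*-identityˡ S) (sym (sum-*ˡ e y _)) ⟩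
  S + sumℤ e (λ u → y * (+ (e C u) * y ^ u))
    ≡⟨ cong (λ x → S + x) (sum-cong e (λ u _ → x∙yz≈y∙xz y (+ (e C u)) (y ^ u))) ⟩
  S + sumℤ e (λ u → + (e C u) * y ^ suc u)
    ≡⟨ sym (sum-pascal e (y ^_)) ⟩
  sumℤ (suc e) (λ u → + (suc e C u) * y ^ u) ∎
  where
  S = sumℤ e (λ u → + (e C u) * y ^ u)
  x∙yz≈y∙xz : ∀ a b c → a * (b * c) ≡ b * (a * c)
  x∙yz≈y∙xz = solve-∀

Δ : ℕ → (ℕ → ℤ) → ℤ
Δ n f = sumℤ n (λ i → + (n C i) * (sgn (n ℕ.∸ i) * f i))

Δ-cong : ∀ n {f g : ℕ → ℤ} → (∀ i → f i ≡ g i) → Δ n f ≡ Δ n g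
Δ-cong n f≡g = sum-cong n (λ i _ → cong (λ x → + (n C i) * (sgn (n ℕ.∸ i) * x)) (f≡g i))

Δ-zero : ∀ n {f : ℕ → ℤ} → (∀ i → f i ≡ + 0) → Δ n f ≡ + 0
Δ-zero n f≡0 = sum-zero n (λ i _ → begin
  + (n C i) * (sgn (n ℕ.∸ i) * _) ≡⟨ cong (λ x → + (n C i) * (sgn (n ℕ.∸ i) * x)) (f≡0 i) ⟩
  + (n C i) * (sgn (n ℕ.∸ i) * + 0) ≡⟨ cong (+ (n C i) *_) (ℤP.*-zeroʳ (sgn (n ℕ.∸ i))) ⟩
  + (n C i) * + 0                   ≡⟨ ℤP.*-zeroʳ (+ (n C i)) ⟩
  + 0                               ∎)

Δ-+ : ∀ n (f g : ℕ → ℤ) → Δ n (λ i → f i + g i) ≡ Δ n f + Δ n g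
Δ-+ n f g = trans (sum-cong n (λ i _ → distrib (+ (n C i)) (sgn (n ℕ.∸ i)) (f i) (g i))) (sum-+ n _ _)
  where
  distrib : ∀ c s x y → c * (s * (x + y)) ≡ c * (s * x) + c * (s * y)
  distrib = solve-∀

Δ-*ˡ : ∀ n c (f : ℕ → ℤ) → Δ n (λ i → c * f i) ≡ c * Δ n f
Δ-*ˡ n c f = trans (sum-cong n (λ i _ → pull (+ (n C i)) (sgn (n ℕ.∸ i)) c (f i))) (sum-*ˡ n c _)
  where
  pull : ∀ b s c x → b * (s * (c * x)) ≡ c * (b * (s * x))
  pull = solve-∀

Δ-sum : ∀ n e (c : ℕ → ℤ) (g : ℕ → ℕ → ℤ) →
  Δ n (λ j → sumℤ e (λ u → c u * g u j)) ≡ sumℤ e (λ u → c u * Δ n (g u))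
Δ-sum n e c g = begin
  sumℤ n (λ j → + (n C j) * (sgn (n ℕ.∸ j) * sumℤ e (λ u → c u * g u j)))
    ≡⟨ sum-cong n (λ j _ → trans (sym (ℤP.*-assoc (+ (n C j)) (sgn (n ℕ.∸ j)) _)) (sym (sum-*ˡ e (+ (n C j) * sgn (n ℕ.∸ j)) (λ u → c u * g u j)))) ⟩
  sumℤ n (λ j → sumℤ e (λ u → (+ (n C j) * sgn (n ℕ.∸ j)) * (c u * g u j)))
    ≡⟨ sum-swap n e _ ⟩
  sumℤ e (λ u → sumℤ n (λ j → (+ (n C j) * sgn (n ℕ.∸ j)) * (c u * g u j)))
    ≡⟨ sum-cong e (λ u _ → trans (sum-cong n (λ j _ → pull (+ (n C j)) _ (c u) (g u j))) (sum-*ˡ n (c u) _)) ⟩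
  sumℤ e (λ u → c u * Δ n (g u)) ∎
  where
  pull : ∀ b s c x → (b * s) * (c * x) ≡ c * (b * (s * x))
  pull = solve-∀

Δ-suc : ∀ n (f : ℕ → ℤ) → Δ (suc n) f ≡ Δ n (λ i → f (suc i) - f i)
Δ-suc n f = begin
  Δ (suc n) f
    ≡⟨ sum-pascal n (λ i → sgn (suc n ℕ.∸ i) * f i) ⟩
  sumℤ n (λ i → + (n C i) * (sgn (suc n ℕ.∸ i) * f i)) + sumℤ n (λ i → + (n C i) * (sgn (n ℕ.∸ i) * f (suc i)))
    ≡⟨ cong (_+ sumℤ n (λ i → + (n C i) * (sgn (n ℕ.∸ i) * f (suc i))))
            (sum-cong n (λ i i≤n → cong (λ s → + (n C i) * (s * f i)) (cong sgn (ℕP.+-∸-assoc 1 i≤n)))) ⟩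
  sumℤ n (λ i → + (n C i) * (- sgn (n ℕ.∸ i) * f i)) + sumℤ n (λ i → + (n C i) * (sgn (n ℕ.∸ i) * f (suc i)))
    ≡⟨ sym (sum-+ n _ _) ⟩
  sumℤ n (λ i → + (n C i) * (- sgn (n ℕ.∸ i) * f i) + + (n C i) * (sgn (n ℕ.∸ i) * f (suc i)))
    ≡⟨ sum-cong n (λ i _ → combine (+ (n C i)) (sgn (n ℕ.∸ i)) (f i) (f (suc i))) ⟩
  Δ n (λ i → f (suc i) - f i) ∎
  where
  combine : ∀ c s x y → c * (- s * x) + c * (s * y) ≡ c * (s * (y - x))
  combine = solve-∀

Δ-shift : ∀ k (g : ℕ → ℤ) → Δ k (λ i → g (suc i)) ≡ Δ (suc k) g + Δ k g
Δ-shift k g = begin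
  Δ k (λ i → g (suc i))                  ≡⟨ Δ-cong k (λ i → sym (cancel (g (suc i)) (g i))) ⟩
  Δ k (λ i → g (suc i) - g i + g i)      ≡⟨ Δ-+ k _ g ⟩
  Δ k (λ i → g (suc i) - g i) + Δ k g    ≡⟨ cong (_+ Δ k g) (sym (Δ-suc k g)) ⟩
  Δ (suc k) g + Δ k g                    ∎
  where
  cancel : ∀ a b → a - b + b ≡ a
  cancel = solve-∀

Δ-index : ∀ k (g : ℕ → ℤ) → Δ (suc k) (λ i → + i * g i) ≡ + suc k * Δ k (λ i → g (suc i))
Δ-index k g = begin
  Δ (suc k) (λ i → + i * g i)
    ≡⟨ sum-suc k _ ⟩
  + 1 * (sgn (suc k) * (+ 0 * g 0)) + sumℤ k (λ i → + (suc k C suc i) * (sgn (k ℕ.∸ i) * (+ suc i * g (suc i))))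
    ≡⟨ cong₂ _+_ (vanish (sgn (suc k)) (g 0)) (sum-cong k (λ i _ → absorb i)) ⟩
  + 0 + sumℤ k (λ i → + suc k * (+ (k C i) * (sgn (k ℕ.∸ i) * g (suc i))))
    ≡⟨ trans (ℤP.+-identityˡ _) (sum-*ˡ k (+ suc k) _) ⟩
  + suc k * Δ k (λ i → g (suc i)) ∎
  where
  vanish : ∀ s x → + 1 * (s * (+ 0 * x)) ≡ + 0
  vanish = solve-∀
  regroup : ∀ c s i x → c * (s * (i * x)) ≡ (i * c) * (s * x)
  regroup = solve-∀
  absorb : ∀ i → + (suc k C suc i) * (sgn (k ℕ.∸ i) * (+ suc i * g (suc i))) ≡
                 + suc k * (+ (k C i) * (sgn (k ℕ.∸ i) * g (suc i)))
  absorb i = begin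
    + (suc k C suc i) * (sgn (k ℕ.∸ i) * (+ suc i * g (suc i)))
      ≡⟨ regroup (+ (suc k C suc i)) (sgn (k ℕ.∸ i)) (+ suc i) (g (suc i)) ⟩
    (+ suc i * + (suc k C suc i)) * (sgn (k ℕ.∸ i) * g (suc i))
      ≡⟨ cong (_* (sgn (k ℕ.∸ i) * g (suc i))) (trans (sym (ℤP.pos-* (suc i) _))
           (trans (cong +_ (C-absorb k i)) (ℤP.pos-* (suc k) (k C i)))) ⟩
    (+ suc k * + (k C i)) * (sgn (k ℕ.∸ i) * g (suc i))
      ≡⟨ ℤP.*-assoc (+ suc k) (+ (k C i)) (sgn (k ℕ.∸ i) * g (suc i)) ⟩
    + suc k * (+ (k C i) * (sgn (k ℕ.∸ i) * g (suc i))) ∎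

Δ-affine : ∀ a k (g : ℕ → ℤ) → Δ (suc k) (λ i → (+ 1 + a * + i) * g i) ≡
  (+ 1 + a * + suc k) * Δ (suc k) g + a * + suc k * Δ k g
Δ-affine a k g = begin
  Δ (suc k) (λ i → (+ 1 + a * + i) * g i)                        ≡⟨ Δ-cong (suc k) (λ i → expand a (+ i) (g i)) ⟩
  Δ (suc k) (λ i → g i + a * (+ i * g i))                        ≡⟨ Δ-+ (suc k) g _ ⟩
  Δ (suc k) g + Δ (suc k) (λ i → a * (+ i * g i))                ≡⟨ cong (λ x → Δ (suc k) g + x) (Δ-*ˡ (suc k) a _) ⟩
  Δ (suc k) g + a * Δ (suc k) (λ i → + i * g i)                  ≡⟨ cong (λ x → Δ (suc k) g + a * x) (Δ-index k g) ⟩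
  Δ (suc k) g + a * (+ suc k * Δ k (λ i → g (suc i)))            ≡⟨ cong (λ x → Δ (suc k) g + a * (+ suc k * x)) (Δ-shift k g) ⟩
  Δ (suc k) g + a * (+ suc k * (Δ (suc k) g + Δ k g))            ≡⟨ regroup a (Δ (suc k) g) (Δ k g) (+ suc k) ⟩
  (+ 1 + a * + suc k) * Δ (suc k) g + a * + suc k * Δ k g        ∎
  where
  expand : ∀ a i x → (+ 1 + a * i) * x ≡ x + a * (i * x)
  expand = solve-∀
  regroup : ∀ a x y c → x + a * (c * (x + y)) ≡ (+ 1 + a * c) * x + a * c * y
  regroup = solve-∀

pow-difference : ∀ e j → (+ suc j) ^ suc e - (+ j) ^ suc e ≡ sumℤ e (λ u → + (suc e C u) * (+ j) ^ u)
pow-difference e j = begin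
  (+ suc j) ^ suc e - (+ j) ^ suc e
    ≡⟨ cong (_- (+ j) ^ suc e) (binomial (suc e) (+ j)) ⟩
  S + + (suc e C suc e) * (+ j) ^ suc e - (+ j) ^ suc e
    ≡⟨ cong (λ c → S + + c * (+ j) ^ suc e - (+ j) ^ suc e) (nCn≡1 (suc e)) ⟩
  S + + 1 * (+ j) ^ suc e - (+ j) ^ suc e
    ≡⟨ cancel S ((+ j) ^ suc e) ⟩
  S ∎
  where
  S = sumℤ e (λ u → + (suc e C u) * (+ j) ^ u)
  cancel : ∀ a b → a + + 1 * b - b ≡ a
  cancel = solve-∀

Δ-pow-suc : ∀ n e → Δ (suc n) (λ j → (+ j) ^ suc e) ≡ sumℤ e (λ u → + (suc e C u) * Δ n (λ j → (+ j) ^ u))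
Δ-pow-suc n e = begin
  Δ (suc n) (λ j → (+ j) ^ suc e)                              ≡⟨ Δ-suc n _ ⟩
  Δ n (λ j → (+ suc j) ^ suc e - (+ j) ^ suc e)                  ≡⟨ Δ-cong n (pow-difference e) ⟩
  Δ n (λ j → sumℤ e (λ u → + (suc e C u) * (+ j) ^ u))         ≡⟨ Δ-sum n e (λ u → + (suc e C u)) (λ u j → (+ j) ^ u) ⟩
  sumℤ e (λ u → + (suc e C u) * Δ n (λ j → (+ j) ^ u))         ∎

Δ-pow< : ∀ n e → e < n → Δ n (λ j → (+ j) ^ e) ≡ + 0
Δ-pow< (suc n) zero    _         = trans (Δ-suc n _) (Δ-zero n (λ _ → refl))
Δ-pow< (suc n) (suc e) (s≤s e<n) = trans (Δ-pow-suc n e) (sum-zero e (λ u u≤e →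
  trans (cong (+ (suc e C u) *_) (Δ-pow< n u (ℕP.≤-<-trans u≤e e<n))) (ℤP.*-zeroʳ (+ (suc e C u)))))

Δ-pow≡ : ∀ n → Δ n (λ j → (+ j) ^ n) ≡ + (n !)
Δ-pow≡ zero    = refl
Δ-pow≡ (suc n) = begin
  Δ (suc n) (λ j → (+ j) ^ suc n)                       ≡⟨ Δ-pow-suc n n ⟩
  sumℤ n (λ u → + (suc n C u) * Δ n (λ j → (+ j) ^ u))  ≡⟨ sum-last n (λ u u<n →
                                                          trans (cong (+ (suc n C u) *_) (Δ-pow< n u u<n)) (ℤP.*-zeroʳ (+ (suc n C u)))) ⟩
  + (suc n C n) * Δ n (λ j → (+ j) ^ n)                 ≡⟨ cong₂ (λ c d → + c * d) [n+1]Cn≡n+1 (Δ-pow≡ n) ⟩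
  + suc n * + (n !)                                   ≡⟨ sym (ℤP.pos-* (suc n) (n !)) ⟩
  + (suc n !)                                         ∎
  where
  [n+1]Cn≡n+1 : suc n C n ≡ suc n
  [n+1]Cn≡n+1 = trans (nCk≡nC[n∸k] (ℕP.n≤1+n n)) (trans (cong (suc n C_) (ℕP.m+n∸n≡m 1 n)) (nC1≡n (suc n)))

n!∣Δ-pow : ∀ n e → e ≤ n → + (n !) ∣ Δ n (λ j → (+ j) ^ e)
n!∣Δ-pow n e e≤n with ℕP.m≤n⇒m<n∨m≡n e≤n
... | inj₁ e<n  = divides (+ 0) (trans (Δ-pow< n e e<n) (sym (ℤP.*-zeroˡ (+ (n !)))))
... | inj₂ refl = ∣-reflexive (sym (Δ-pow≡ n))

shift : (ℕ → ℤ) → ℕ → ℤ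
shift f zero    = + 0
shift f (suc r) = f r

shift-sum : ∀ K (a : ℕ → ℤ) (g : ℕ → ℕ → ℤ) r →
  sumℤ K (λ k → a k * shift (g k) r) ≡ shift (λ r → sumℤ K (λ k → a k * g k r)) r
shift-sum K a g zero    = sum-zero K (λ k _ → ℤP.*-zeroʳ (a k))
shift-sum K a g (suc r) = refl

shift-cong : ∀ {f g : ℕ → ℤ} → (∀ r → f r ≡ g r) → ∀ r → shift f r ≡ shift g r
shift-cong f≡g zero    = refl
shift-cong f≡g (suc r) = f≡g r

shift-vanish : ∀ j {f : ℕ → ℤ} → (∀ r → r < j → f r ≡ + 0) → ∀ r → r ≤ j → shift f r ≡ + 0
shift-vanish j f≡0 zero    _   = refl
shift-vanish j f≡0 (suc r) r<j = f≡0 r r<j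

δ : ℕ → ℕ → ℤ
δ zero    zero    = + 1
δ zero    (suc r) = + 0
δ (suc j) zero    = + 0
δ (suc j) (suc r) = δ j r

shift-δ : ∀ j r → shift (δ j) r ≡ δ (suc j) r
shift-δ j zero    = refl
shift-δ j (suc r) = refl

δ-+ : ∀ j q → δ j (j ℕ.+ q) ≡ δ 0 q
δ-+ zero    q = refl
δ-+ (suc j) q = δ-+ j q

δ-< : ∀ j r → r < j → δ j r ≡ + 0
δ-< (suc j) zero    _         = refl
δ-< (suc j) (suc r) (s≤s r<j) = δ-< j r r<j

*-δ : ∀ (f : ℕ → ℤ) j r → f r * δ j r ≡ f j * δ j r
*-δ f zero    zero    = refl
*-δ f zero    (suc r) = trans (ℤP.*-zeroʳ (f (suc r))) (sym (ℤP.*-zeroʳ (f zero)))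
*-δ f (suc j) zero    = trans (ℤP.*-zeroʳ (f zero)) (sym (ℤP.*-zeroʳ (f (suc j))))
*-δ f (suc j) (suc r) = *-δ (λ r → f (suc r)) j r

eval : ℕ → ℤ → (ℕ → ℤ) → ℤ
eval B t f = sumℤ B (λ r → f r * t ^ r)

eval-cong : ∀ B t {f g : ℕ → ℤ} → (∀ r → f r ≡ g r) → eval B t f ≡ eval B t g
eval-cong B t f≡g = sum-cong B (λ r _ → cong (_* t ^ r) (f≡g r))

eval-sum : ∀ B t K (a : ℕ → ℤ) (g : ℕ → ℕ → ℤ) →
  eval B t (λ r → sumℤ K (λ k → a k * g k r)) ≡ sumℤ K (λ k → a k * eval B t (g k))
eval-sum B t K a g = begin
  sumℤ B (λ r → sumℤ K (λ k → a k * g k r) * t ^ r)   ≡⟨ sum-cong B (λ r _ → sym (sum-*ʳ K (t ^ r) _)) ⟩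
  sumℤ B (λ r → sumℤ K (λ k → a k * g k r * t ^ r))   ≡⟨ sum-swap B K _ ⟩
  sumℤ K (λ k → sumℤ B (λ r → a k * g k r * t ^ r))   ≡⟨ sum-cong K (λ k _ → trans
                                                           (sum-cong B (λ r _ → ℤP.*-assoc (a k) (g k r) (t ^ r)))
                                                           (sum-*ˡ B (a k) _)) ⟩
  sumℤ K (λ k → a k * eval B t (g k))                  ∎

eval-extend : ∀ N B t {f : ℕ → ℤ} → N ≤ B → (∀ r → N < r → f r ≡ + 0) → eval B t f ≡ eval N t f
eval-extend N B t {f} N≤B f≡0 =
  sum-extend N B N≤B (λ r N<r _ → trans (cong (_* t ^ r) (f≡0 r N<r)) (ℤP.*-zeroˡ (t ^ r)))

eval-drop : ∀ j Q t {f : ℕ → ℤ} → (∀ r → r < j → f r ≡ + 0) →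
  eval (j ℕ.+ Q) t f ≡ t ^ j * eval Q t (λ q → f (j ℕ.+ q))
eval-drop j Q t {f} f≡0 = begin
  sumℤ (j ℕ.+ Q) (λ r → f r * t ^ r)
    ≡⟨ sum-drop j Q (λ r r<j → trans (cong (_* t ^ r) (f≡0 r r<j)) (ℤP.*-zeroˡ (t ^ r))) ⟩
  sumℤ Q (λ q → f (j ℕ.+ q) * t ^ (j ℕ.+ q))
    ≡⟨ sum-cong Q (λ q _ → trans (cong (f (j ℕ.+ q) *_) (ℤP.^-distribˡ-+-* t j q)) (pull (f (j ℕ.+ q)) (t ^ j) (t ^ q))) ⟩
  sumℤ Q (λ q → t ^ j * (f (j ℕ.+ q) * t ^ q))
    ≡⟨ sum-*ˡ Q (t ^ j) _ ⟩
  t ^ j * eval Q t (λ q → f (j ℕ.+ q)) ∎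
  where
  pull : ∀ x a b → x * (a * b) ≡ a * (x * b)
  pull = solve-∀

module _ (m : ℕ) where

  weight : ℕ → ℤ
  weight r = + 1 + + m * + r

  step : (ℕ → ℤ) → ℕ → ℤ
  step f r = shift f r + weight r * f r

  step^ : ℕ → (ℕ → ℤ) → ℕ → ℤ
  step^ zero    f = f
  step^ (suc i) f = step (step^ i f)

  step-cong : ∀ {f g : ℕ → ℤ} → (∀ r → f r ≡ g r) → ∀ r → step f r ≡ step g r
  step-cong {f} {g} f≡g zero    = cong (λ x → + 0 + weight 0 * x) (f≡g 0)
  step-cong {f} {g} f≡g (suc r) = cong₂ (λ x y → x + weight (suc r) * y) (f≡g r) (f≡g (suc r))

  step^-cong : ∀ i {f g : ℕ → ℤ} → (∀ r → f r ≡ g r) → ∀ r → step^ i f r ≡ step^ i g r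
  step^-cong zero    f≡g = f≡g
  step^-cong (suc i) f≡g = step-cong (step^-cong i f≡g)

  step-sum : ∀ K (a : ℕ → ℤ) (g : ℕ → ℕ → ℤ) r →
    sumℤ K (λ k → a k * step (g k) r) ≡ step (λ r → sumℤ K (λ k → a k * g k r)) r
  step-sum K a g r = begin
    sumℤ K (λ k → a k * (shift (g k) r + weight r * g k r))
      ≡⟨ sum-cong K (λ k _ → distrib (a k) (shift (g k) r) (weight r) (g k r)) ⟩
    sumℤ K (λ k → a k * shift (g k) r + weight r * (a k * g k r))
      ≡⟨ sum-+ K _ _ ⟩
    sumℤ K (λ k → a k * shift (g k) r) + sumℤ K (λ k → weight r * (a k * g k r))
      ≡⟨ cong₂ _+_ (shift-sum K a g r) (sum-*ˡ K (weight r) (λ k → a k * g k r)) ⟩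
    step (λ r → sumℤ K (λ k → a k * g k r)) r ∎
    where
    distrib : ∀ a x w y → a * (x + w * y) ≡ a * x + w * (a * y)
    distrib = solve-∀

  step^-sum : ∀ i K (a : ℕ → ℤ) (g : ℕ → ℕ → ℤ) r →
    sumℤ K (λ k → a k * step^ i (g k) r) ≡ step^ i (λ r → sumℤ K (λ k → a k * g k r)) r
  step^-sum zero    K a g r = refl
  step^-sum (suc i) K a g r =
    trans (step-sum K a (λ k → step^ i (g k)) r) (step-cong (step^-sum i K a g) r)

  step-vanish : ∀ j {f : ℕ → ℤ} → (∀ r → r < j → f r ≡ + 0) → ∀ r → r < j → step f r ≡ + 0
  step-vanish j {f} f≡0 r r<j = begin
    shift f r + weight r * f r ≡⟨ cong₂ _+_ (shift-vanish j f≡0 r (ℕP.<⇒≤ r<j)) (cong (weight r *_) (f≡0 r r<j)) ⟩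
    + 0 + weight r * + 0       ≡⟨ trans (ℤP.+-identityˡ _) (ℤP.*-zeroʳ (weight r)) ⟩
    + 0                        ∎

  step^-vanish : ∀ i j {f : ℕ → ℤ} → (∀ r → r < j → f r ≡ + 0) → ∀ r → r < j → step^ i f r ≡ + 0
  step^-vanish zero    j f≡0 = f≡0
  step^-vanish (suc i) j f≡0 = step-vanish j (step^-vanish i j f≡0)

  step^-+ : ∀ i k (f : ℕ → ℤ) → step^ (i ℕ.+ k) f ≡ step^ i (step^ k f)
  step^-+ zero    k f = refl
  step^-+ (suc i) k f = cong step (step^-+ i k f)

  weight-+ : ∀ j q → weight (j ℕ.+ q) ≡ + m * + j + weight q
  weight-+ j q = trans (cong (λ x → + 1 + + m * x) (ℤP.pos-+ j q)) (regroup (+ m) (+ j) (+ q))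
    where
    regroup : ∀ c a b → + 1 + c * (a + b) ≡ c * a + (+ 1 + c * b)
    regroup = solve-∀

  -- After the shift by j, step acts on sequences supported in [j, ∞) as step + m j (weight-+);
  -- the sum is the binomial expansion of (step + m j)^i.
  step^-offset : ∀ i j {f : ℕ → ℤ} → (∀ r → r < j → f r ≡ + 0) → ∀ q →
    step^ i f (j ℕ.+ q) ≡
    sumℤ i (λ p → (+ (i C p) * (+ m * + j) ^ (i ℕ.∸ p)) * step^ p (λ q → f (j ℕ.+ q)) q)
  step^-offset zero    j {f} _   q = sym (ℤP.*-identityˡ (f (j ℕ.+ q)))
  step^-offset (suc i) j {f} f≡0 q = begin
    shift (step^ i f) (j ℕ.+ q) + weight (j ℕ.+ q) * step^ i f (j ℕ.+ q)
      ≡⟨ cong₂ (λ x y → x + y * step^ i f (j ℕ.+ q)) (shift-offset q) (weight-+ j q) ⟩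
    shift (λ q → step^ i f (j ℕ.+ q)) q + (a + weight q) * step^ i f (j ℕ.+ q)
      ≡⟨ cong₂ (λ x y → x + (a + weight q) * y) (shift-cong (step^-offset i j f≡0) q) (step^-offset i j f≡0 q) ⟩
    shift (V i) q + (a + weight q) * V i q
      ≡⟨ regroup (shift (V i) q) a (weight q) (V i q) ⟩
    a * V i q + step (V i) q
      ≡⟨ cong (λ x → a * V i q + x) (sym (step-sum i (λ p → + (i C p) * a ^ (i ℕ.∸ p)) (λ p → step^ p g) q)) ⟩
    a * V i q + sumℤ i (λ p → (+ (i C p) * a ^ (i ℕ.∸ p)) * step^ (suc p) g q)
      ≡⟨ cong₂ _+_ (sym lower) (sum-cong i (λ p _ → ℤP.*-assoc (+ (i C p)) (a ^ (i ℕ.∸ p)) (step^ (suc p) g q))) ⟩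
    sumℤ i (λ p → + (i C p) * F p) + sumℤ i (λ p → + (i C p) * F (suc p))
      ≡⟨ sym (sum-pascal i F) ⟩
    sumℤ (suc i) (λ p → + (suc i C p) * F p)
      ≡⟨ sum-cong (suc i) (λ p _ → sym (ℤP.*-assoc (+ (suc i C p)) _ _)) ⟩
    V (suc i) q ∎
    where
    a = + m * + j
    g = λ q → f (j ℕ.+ q)
    V : ℕ → ℕ → ℤ
    V i q = sumℤ i (λ p → (+ (i C p) * a ^ (i ℕ.∸ p)) * step^ p g q)
    F : ℕ → ℤ
    F p = a ^ (suc i ℕ.∸ p) * step^ p g q
    regroup : ∀ s a w v → s + (a + w) * v ≡ a * v + (s + w * v)
    regroup = solve-∀
    shift-offset : ∀ q → shift (step^ i f) (j ℕ.+ q) ≡ shift (λ q → step^ i f (j ℕ.+ q)) q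
    shift-offset (suc q) = cong (shift (step^ i f)) (ℕP.+-suc j q)
    shift-offset zero    = shift-vanish j (step^-vanish i j f≡0) (j ℕ.+ 0) (ℕP.≤-reflexive (ℕP.+-identityʳ j))
    lower : sumℤ i (λ p → + (i C p) * F p) ≡ a * V i q
    lower = begin
      sumℤ i (λ p → + (i C p) * (a ^ (suc i ℕ.∸ p) * step^ p g q))
        ≡⟨ sum-cong i (λ p p≤i → cong (λ e → + (i C p) * (a ^ e * step^ p g q)) (ℕP.+-∸-assoc 1 p≤i)) ⟩
      sumℤ i (λ p → + (i C p) * (a * a ^ (i ℕ.∸ p) * step^ p g q))
        ≡⟨ sum-cong i (λ p _ → pull (+ (i C p)) a (a ^ (i ℕ.∸ p)) (step^ p g q)) ⟩
      sumℤ i (λ p → a * ((+ (i C p) * a ^ (i ℕ.∸ p)) * step^ p g q))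
        ≡⟨ sum-*ˡ i a _ ⟩
      a * V i q ∎
      where
      pull : ∀ c a x y → c * (a * x * y) ≡ a * ((c * x) * y)
      pull = solve-∀

  whitney₂ : ℕ → ℕ → ℤ
  whitney₂ N = step^ N (δ 0)

  whitney₂-vanish : ∀ N r → N < r → whitney₂ N r ≡ + 0
  whitney₂-vanish zero    (suc r) _ = refl
  whitney₂-vanish (suc N) (suc r) (s≤s N<r) = begin
    whitney₂ N r + weight (suc r) * whitney₂ N (suc r)
      ≡⟨ cong₂ (λ x y → x + weight (suc r) * y) (whitney₂-vanish N r N<r) (whitney₂-vanish N (suc r) (ℕP.m<n⇒m<1+n N<r)) ⟩
    + 0 + weight (suc r) * + 0
      ≡⟨ trans (ℤP.+-identityˡ _) (ℤP.*-zeroʳ (weight (suc r))) ⟩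
    + 0 ∎

  Δ-weight-power : ∀ N k → Δ k (λ i → weight i ^ N) ≡ whitney₂ N k * + (m ℕ.^ k ℕ.* k !)
  Δ-weight-power zero    zero    = refl
  Δ-weight-power zero    (suc k) = trans (Δ-suc k _) (Δ-zero k (λ _ → refl))
  Δ-weight-power (suc N) zero    = begin
    + 1 * (+ 1 * (weight 0 * weight 0 ^ N))  ≡⟨ pull (weight 0) (weight 0 ^ N) ⟩
    weight 0 * Δ 0 (λ i → weight i ^ N)      ≡⟨ cong (weight 0 *_) (Δ-weight-power N 0) ⟩
    weight 0 * (whitney₂ N 0 * + 1)          ≡⟨ push (weight 0) (whitney₂ N 0) ⟩
    whitney₂ (suc N) 0 * + 1                 ∎
    where
    pull : ∀ w x → + 1 * (+ 1 * (w * x)) ≡ w * (+ 1 * (+ 1 * x))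
    pull = solve-∀
    push : ∀ w x → w * (x * + 1) ≡ (+ 0 + w * x) * + 1
    push = solve-∀
  Δ-weight-power (suc N) (suc k) = begin
    Δ (suc k) (λ i → weight i * weight i ^ N)
      ≡⟨ Δ-affine (+ m) k (λ i → weight i ^ N) ⟩
    weight (suc k) * Δ (suc k) (λ i → weight i ^ N) + + m * + suc k * Δ k (λ i → weight i ^ N)
      ≡⟨ cong₂ (λ x y → weight (suc k) * x + + m * + suc k * y) (Δ-weight-power N (suc k)) (Δ-weight-power N k) ⟩
    weight (suc k) * (W₁ * scale (suc k)) + + m * + suc k * (W₀ * scale k)
      ≡⟨ cong (λ s → weight (suc k) * (W₁ * s) + + m * + suc k * (W₀ * scale k)) scale-suc ⟩
    weight (suc k) * (W₁ * (+ m * + suc k * scale k)) + + m * + suc k * (W₀ * scale k)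
      ≡⟨ regroup (weight (suc k)) W₁ W₀ (+ m * + suc k) (scale k) ⟩
    (W₀ + weight (suc k) * W₁) * (+ m * + suc k * scale k)
      ≡⟨ cong ((W₀ + weight (suc k) * W₁) *_) (sym scale-suc) ⟩
    whitney₂ (suc N) (suc k) * scale (suc k) ∎
    where
    W₁ = whitney₂ N (suc k)
    W₀ = whitney₂ N k
    scale : ℕ → ℤ
    scale k = + (m ℕ.^ k ℕ.* k !)
    scale-suc : scale (suc k) ≡ + m * + suc k * scale k
    scale-suc = trans (cong +_ (interchange m (m ℕ.^ k) (suc k) (k !)))
                      (trans (ℤP.pos-* (m ℕ.* suc k) _) (cong (_* scale k) (ℤP.pos-* m (suc k))))
      where
      interchange : ∀ a b c d → a ℕ.* b ℕ.* (c ℕ.* d) ≡ a ℕ.* c ℕ.* (b ℕ.* d)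
      interchange = ℕS.solve-∀
    regroup : ∀ w x y c s → w * (x * (c * s)) + c * (y * s) ≡ (y + w * x) * (c * s)
    regroup = solve-∀

  Δ-dowling-power : ∀ N k → Δ k (λ i → (+ (m ℕ.* i ℕ.+ 1)) ^ N) ≡ whitney₂ N k * + (m ℕ.^ k ℕ.* k !)
  Δ-dowling-power N k = trans (Δ-cong k (λ i → cong (_^ N) (base i))) (Δ-weight-power N k)
    where
    base : ∀ i → + (m ℕ.* i ℕ.+ 1) ≡ weight i
    base i = trans (ℤP.pos-+ (m ℕ.* i) 1) (trans (cong (_+ + 1) (ℤP.pos-* m i)) (ℤP.+-comm (+ m * + i) (+ 1)))

  whitney₁ : ℕ → ℕ → ℤ
  whitney₁ zero      = δ 0
  whitney₁ (suc j) k = shift (whitney₁ j) k - weight j * whitney₁ j k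

  whitney₁-vanish : ∀ j k → j < k → whitney₁ j k ≡ + 0
  whitney₁-vanish zero    (suc k) _ = refl
  whitney₁-vanish (suc j) (suc k) (s≤s j<k) = begin
    whitney₁ j k - weight j * whitney₁ j (suc k)
      ≡⟨ cong₂ (λ x y → x - weight j * y) (whitney₁-vanish j k j<k) (whitney₁-vanish j (suc k) (ℕP.m<n⇒m<1+n j<k)) ⟩
    + 0 - weight j * + 0
      ≡⟨ cong (λ x → + 0 - x) (ℤP.*-zeroʳ (weight j)) ⟩
    + 0 ∎

  step-δ : ∀ j r → step (δ j) r ≡ δ (suc j) r + weight j * δ j r
  step-δ j r = cong₂ _+_ (shift-δ j r) (*-δ weight j r)

  whitney-orthogonal : ∀ j K → j ≤ K → ∀ r → sumℤ K (λ k → whitney₁ j k * whitney₂ k r) ≡ δ j r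
  whitney-orthogonal zero K _ r = begin
    sumℤ K (λ k → whitney₁ 0 k * whitney₂ k r) ≡⟨ sum-extend 0 K z≤n (λ { (suc k) _ _ → ℤP.*-zeroˡ (whitney₂ (suc k) r) }) ⟩
    + 1 * δ 0 r                                ≡⟨ ℤP.*-identityˡ (δ 0 r) ⟩
    δ 0 r                                      ∎
  whitney-orthogonal (suc j) (suc K) (s≤s j≤K) r = begin
    sumℤ (suc K) (λ k → (shift (whitney₁ j) k - weight j * whitney₁ j k) * whitney₂ k r)
      ≡⟨ sum-cong (suc K) (λ k _ → distrib (shift (whitney₁ j) k) (weight j) (whitney₁ j k) (whitney₂ k r)) ⟩
    sumℤ (suc K) (λ k → shift (whitney₁ j) k * whitney₂ k r - weight j * (whitney₁ j k * whitney₂ k r))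
      ≡⟨ sum-minus (suc K) _ _ ⟩
    sumℤ (suc K) (λ k → shift (whitney₁ j) k * whitney₂ k r) - sumℤ (suc K) (λ k → weight j * (whitney₁ j k * whitney₂ k r))
      ≡⟨ cong₂ _-_ raised (trans (sum-*ˡ (suc K) (weight j) (λ k → whitney₁ j k * whitney₂ k r)) (cong (weight j *_) same)) ⟩
    δ (suc j) r + weight j * δ j r - weight j * δ j r
      ≡⟨ cancel (δ (suc j) r) (weight j * δ j r) ⟩
    δ (suc j) r ∎
    where
    distrib : ∀ a w b x → (a - w * b) * x ≡ a * x - w * (b * x)
    distrib = solve-∀
    cancel : ∀ a b → a + b - b ≡ a
    cancel = solve-∀
    same : sumℤ (suc K) (λ k → whitney₁ j k * whitney₂ k r) ≡ δ j r
    same = trans (sum-extend K (suc K) (ℕP.n≤1+n K) (λ k K<k _ →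
                   trans (cong (_* whitney₂ k r) (whitney₁-vanish j k (ℕP.≤-<-trans j≤K K<k))) (ℤP.*-zeroˡ (whitney₂ k r))))
                 (whitney-orthogonal j K j≤K r)
    raised : sumℤ (suc K) (λ k → shift (whitney₁ j) k * whitney₂ k r) ≡ δ (suc j) r + weight j * δ j r
    raised = begin
      sumℤ (suc K) (λ k → shift (whitney₁ j) k * whitney₂ k r)
        ≡⟨ trans (sum-suc K _) (trans (cong (_+ sumℤ K (λ k → whitney₁ j k * step (whitney₂ k) r)) (ℤP.*-zeroˡ (whitney₂ 0 r))) (ℤP.+-identityˡ _)) ⟩
      sumℤ K (λ k → whitney₁ j k * step (whitney₂ k) r)
        ≡⟨ step-sum K (whitney₁ j) whitney₂ r ⟩
      step (λ r → sumℤ K (λ k → whitney₁ j k * whitney₂ k r)) r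
        ≡⟨ step-cong (whitney-orthogonal j K j≤K) r ⟩
      step (δ j) r
        ≡⟨ step-δ j r ⟩
      δ (suc j) r + weight j * δ j r ∎

  ccoef-suc : ∀ l k → ccoef m (suc l) k ≡ shift (ccoef m l) k - + (m ℕ.* l) * ccoef m l k
  ccoef-suc l       (suc k) = refl
  ccoef-suc zero    zero    = cong (λ x → + 0 - + x * + 1) (sym (ℕP.*-zeroʳ m))
  ccoef-suc (suc l) zero    = cong (λ x → + 0 - x) (sym (ℤP.*-zeroʳ (+ (m ℕ.* suc l))))

  weight-∸ : ∀ j l → l ≤ j → + (1 ℕ.+ m ℕ.* (j ℕ.∸ l)) ≡ weight j - + (m ℕ.* l)
  weight-∸ j l l≤j = begin
    + (1 ℕ.+ m ℕ.* (j ℕ.∸ l))                        ≡⟨ sym (cancel _ (+ (m ℕ.* l))) ⟩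
    + (1 ℕ.+ m ℕ.* (j ℕ.∸ l)) + + (m ℕ.* l) - + (m ℕ.* l) ≡⟨ cong (_- + (m ℕ.* l)) (sym (ℤP.pos-+ (1 ℕ.+ m ℕ.* (j ℕ.∸ l)) _)) ⟩
    + (1 ℕ.+ m ℕ.* (j ℕ.∸ l) ℕ.+ m ℕ.* l) - + (m ℕ.* l)  ≡⟨ cong (λ x → + x - + (m ℕ.* l)) nat ⟩
    + (1 ℕ.+ m ℕ.* j) - + (m ℕ.* l)                   ≡⟨ cong (λ x → + 1 + x - + (m ℕ.* l)) (ℤP.pos-* m j) ⟩
    weight j - + (m ℕ.* l)                            ∎
    where
    cancel : ∀ a b → a + b - b ≡ a
    cancel = solve-∀
    nat : 1 ℕ.+ m ℕ.* (j ℕ.∸ l) ℕ.+ m ℕ.* l ≡ 1 ℕ.+ m ℕ.* j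
    nat = cong suc (trans (sym (ℕP.*-distribˡ-+ m (j ℕ.∸ l) l)) (cong (m ℕ.*_) (ℕP.m∸n+n≡m l≤j)))

  whitney₁-egf : ∀ j k → sumℤ j (λ l → + (j C l) * bcoef m (j ℕ.∸ l) * ccoef m l k) ≡ whitney₁ j k
  whitney₁-egf zero    zero    = refl
  whitney₁-egf zero    (suc k) = refl
  whitney₁-egf (suc j) k = begin
    sumℤ (suc j) (λ l → + (suc j C l) * b (suc j ℕ.∸ l) * c l k)
      ≡⟨ sum-cong (suc j) (λ l _ → ℤP.*-assoc (+ (suc j C l)) _ _) ⟩
    sumℤ (suc j) (λ l → + (suc j C l) * F l)
      ≡⟨ sum-pascal j F ⟩
    sumℤ j (λ l → + (j C l) * F l) + sumℤ j (λ l → + (j C l) * F (suc l))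
      ≡⟨ sym (sum-+ j _ _) ⟩
    sumℤ j (λ l → + (j C l) * F l + + (j C l) * F (suc l))
      ≡⟨ sum-cong j termwise ⟩
    sumℤ j (λ l → B l * shift (c l) k - weight j * (B l * c l k))
      ≡⟨ sum-minus j _ _ ⟩
    sumℤ j (λ l → B l * shift (c l) k) - sumℤ j (λ l → weight j * (B l * c l k))
      ≡⟨ cong₂ _-_ (shift-sum j B c k) (sum-*ˡ j (weight j) _) ⟩
    shift (λ k → sumℤ j (λ l → B l * c l k)) k - weight j * sumℤ j (λ l → B l * c l k)
      ≡⟨ cong₂ (λ x y → x - weight j * y) (shift-cong (whitney₁-egf j) k) (whitney₁-egf j k) ⟩
    whitney₁ (suc j) k ∎
    where
    b = bcoef m
    c = ccoef m
    B : ℕ → ℤ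
    B l = + (j C l) * b (j ℕ.∸ l)
    F : ℕ → ℤ
    F l = b (suc j ℕ.∸ l) * c l k
    combine : ∀ C w x b X c → C * (- ((w - x) * b) * c) + C * (b * (X - x * c)) ≡ (C * b) * X - w * ((C * b) * c)
    combine = solve-∀
    termwise : ∀ l → l ≤ j → + (j C l) * F l + + (j C l) * F (suc l) ≡ B l * shift (c l) k - weight j * (B l * c l k)
    termwise l l≤j = begin
      + (j C l) * (b (suc j ℕ.∸ l) * c l k) + + (j C l) * (b (j ℕ.∸ l) * c (suc l) k)
        ≡⟨ cong₂ (λ x y → + (j C l) * (b x * c l k) + + (j C l) * (b (j ℕ.∸ l) * y)) (ℕP.+-∸-assoc 1 l≤j) (ccoef-suc l k) ⟩
      + (j C l) * (- (+ (1 ℕ.+ m ℕ.* (j ℕ.∸ l)) * b (j ℕ.∸ l)) * c l k)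
        + + (j C l) * (b (j ℕ.∸ l) * (shift (c l) k - + (m ℕ.* l) * c l k))
        ≡⟨ cong (λ w → + (j C l) * (- (w * b (j ℕ.∸ l)) * c l k)
                        + + (j C l) * (b (j ℕ.∸ l) * (shift (c l) k - + (m ℕ.* l) * c l k))) (weight-∸ j l l≤j) ⟩
      + (j C l) * (- ((weight j - + (m ℕ.* l)) * b (j ℕ.∸ l)) * c l k)
        + + (j C l) * (b (j ℕ.∸ l) * (shift (c l) k - + (m ℕ.* l) * c l k))
        ≡⟨ combine (+ (j C l)) (weight j) (+ (m ℕ.* l)) (b (j ℕ.∸ l)) (shift (c l) k) (c l k) ⟩
      B l * shift (c l) k - weight j * (B l * c l k) ∎

  R≡whitney₁ : ∀ n k t → R m n k t ≡ sumℤ n (λ j → (+ (n C j) * (- t) ^ (n ℕ.∸ j)) * whitney₁ j k)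
  R≡whitney₁ n k t = sum-cong n (λ j _ → cong ((+ (n C j) * (- t) ^ (n ℕ.∸ j)) *_) (whitney₁-egf j k))

  dowling : ℕ → ℤ → ℤ
  dowling N t = eval N t (whitney₂ N)

  dowling-extend : ∀ N B t → N ≤ B → eval B t (whitney₂ N) ≡ dowling N t
  dowling-extend N B t N≤B = eval-extend N B t N≤B (whitney₂-vanish N)

  sum-whitney₁-dowling : ∀ i j K t → j ≤ K →
    sumℤ K (λ k → whitney₁ j k * dowling (i ℕ.+ k) t) ≡
    t ^ j * sumℤ i (λ p → (+ (i C p) * (+ m) ^ (i ℕ.∸ p) * dowling p t) * (+ j) ^ (i ℕ.∸ p))
  sum-whitney₁-dowling i j K t j≤K = begin
    sumℤ K (λ k → whitney₁ j k * dowling (i ℕ.+ k) t)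
      ≡⟨ sum-cong K (λ k k≤K → cong (whitney₁ j k *_) (sym (dowling-extend (i ℕ.+ k) (j ℕ.+ Q) t (i+k≤B k≤K)))) ⟩
    sumℤ K (λ k → whitney₁ j k * eval (j ℕ.+ Q) t (whitney₂ (i ℕ.+ k)))
      ≡⟨ sym (eval-sum (j ℕ.+ Q) t K (whitney₁ j) (λ k → whitney₂ (i ℕ.+ k))) ⟩
    eval (j ℕ.+ Q) t (λ r → sumℤ K (λ k → whitney₁ j k * whitney₂ (i ℕ.+ k) r))
      ≡⟨ eval-cong (j ℕ.+ Q) t collapse ⟩
    eval (j ℕ.+ Q) t (step^ i (δ j))
      ≡⟨ eval-drop j Q t (step^-vanish i j (δ-< j)) ⟩
    t ^ j * eval Q t (λ q → step^ i (δ j) (j ℕ.+ q))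
      ≡⟨ cong (t ^ j *_) (eval-cong Q t (λ q → trans (step^-offset i j (δ-< j) q)
           (sum-cong i (λ p _ → cong (c p *_) (step^-cong p (δ-+ j) q))))) ⟩
    t ^ j * eval Q t (λ q → sumℤ i (λ p → c p * whitney₂ p q))
      ≡⟨ cong (t ^ j *_) (eval-sum Q t i c whitney₂) ⟩
    t ^ j * sumℤ i (λ p → c p * eval Q t (whitney₂ p))
      ≡⟨ cong (t ^ j *_) (sum-cong i (λ p p≤i → cong (c p *_) (dowling-extend p Q t (ℕP.≤-trans p≤i i≤Q)))) ⟩
    t ^ j * sumℤ i (λ p → c p * dowling p t)
      ≡⟨ cong (t ^ j *_) (sum-cong i (λ p _ → split-power p)) ⟩
    t ^ j * sumℤ i (λ p → (+ (i C p) * (+ m) ^ (i ℕ.∸ p) * dowling p t) * (+ j) ^ (i ℕ.∸ p)) ∎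
    where
    Q = i ℕ.+ K ℕ.∸ j
    c : ℕ → ℤ
    c p = + (i C p) * (+ m * + j) ^ (i ℕ.∸ p)
    i≤Q : i ≤ Q
    i≤Q = ℕP.≤-trans (ℕP.m≤m+n i (K ℕ.∸ j)) (ℕP.≤-reflexive (sym (ℕP.+-∸-assoc i j≤K)))
    i+k≤B : ∀ {k} → k ≤ K → i ℕ.+ k ≤ j ℕ.+ Q
    i+k≤B k≤K = ℕP.≤-trans (ℕP.+-monoʳ-≤ i k≤K) (ℕP.≤-reflexive (sym (ℕP.m+[n∸m]≡n (ℕP.≤-trans j≤K (ℕP.m≤n+m K i)))))
    collapse : ∀ r → sumℤ K (λ k → whitney₁ j k * whitney₂ (i ℕ.+ k) r) ≡ step^ i (δ j) r
    collapse r = begin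
      sumℤ K (λ k → whitney₁ j k * whitney₂ (i ℕ.+ k) r)
        ≡⟨ sum-cong K (λ k _ → cong (λ h → whitney₁ j k * h r) (step^-+ i k (δ 0))) ⟩
      sumℤ K (λ k → whitney₁ j k * step^ i (whitney₂ k) r)
        ≡⟨ step^-sum i K (whitney₁ j) whitney₂ r ⟩
      step^ i (λ r → sumℤ K (λ k → whitney₁ j k * whitney₂ k r)) r
        ≡⟨ step^-cong i (whitney-orthogonal j K j≤K) r ⟩
      step^ i (δ j) r ∎
    split-power : ∀ p → c p * dowling p t ≡ (+ (i C p) * (+ m) ^ (i ℕ.∸ p) * dowling p t) * (+ j) ^ (i ℕ.∸ p)
    split-power p = trans (cong (λ y → (+ (i C p) * y) * dowling p t) (^-distribʳ-* (+ m) (+ j) (i ℕ.∸ p)))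
                          (swap (+ (i C p)) ((+ m) ^ (i ℕ.∸ p)) ((+ j) ^ (i ℕ.∸ p)) (dowling p t))
      where
      swap : ∀ a x y z → (a * (x * y)) * z ≡ (a * x * z) * y
      swap = solve-∀

  sum-R-dowling : ∀ n i t → i ≤ n →
    sumℤ n (λ k → R m n k t * dowling (i ℕ.+ k) t) ≡
    t ^ n * sumℤ i (λ p → (+ (i C p) * (+ m) ^ (i ℕ.∸ p) * dowling p t) * Δ n (λ j → (+ j) ^ (i ℕ.∸ p)))
  sum-R-dowling n i t i≤n = begin
    sumℤ n (λ k → R m n k t * dowling (i ℕ.+ k) t)
      ≡⟨ sum-cong n (λ k _ → trans (cong (_* dowling (i ℕ.+ k) t) (R≡whitney₁ n k t)) (sym (sum-*ʳ n _ _))) ⟩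
    sumℤ n (λ k → sumℤ n (λ j → c j * whitney₁ j k * dowling (i ℕ.+ k) t))
      ≡⟨ sum-swap n n _ ⟩
    sumℤ n (λ j → sumℤ n (λ k → c j * whitney₁ j k * dowling (i ℕ.+ k) t))
      ≡⟨ sum-cong n (λ j _ → trans (sum-cong n (λ k _ → ℤP.*-assoc (c j) _ _)) (sum-*ˡ n (c j) _)) ⟩
    sumℤ n (λ j → c j * sumℤ n (λ k → whitney₁ j k * dowling (i ℕ.+ k) t))
      ≡⟨ sum-cong n (λ j j≤n → cong (c j *_) (sum-whitney₁-dowling i j n t j≤n)) ⟩
    sumℤ n (λ j → c j * (t ^ j * X j))
      ≡⟨ sum-cong n (λ j j≤n → termwise j j≤n) ⟩
    Δ n (λ j → t ^ n * X j)
      ≡⟨ Δ-*ˡ n (t ^ n) X ⟩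
    t ^ n * Δ n X
      ≡⟨ cong (t ^ n *_) (Δ-sum n i d (λ p j → (+ j) ^ (i ℕ.∸ p))) ⟩
    t ^ n * sumℤ i (λ p → d p * Δ n (λ j → (+ j) ^ (i ℕ.∸ p))) ∎
    where
    c : ℕ → ℤ
    c j = + (n C j) * (- t) ^ (n ℕ.∸ j)
    d : ℕ → ℤ
    d p = + (i C p) * (+ m) ^ (i ℕ.∸ p) * dowling p t
    X : ℕ → ℤ
    X j = sumℤ i (λ p → d p * (+ j) ^ (i ℕ.∸ p))
    regroup : ∀ a b c x → (a * b) * (c * x) ≡ a * (b * c * x)
    regroup = solve-∀
    termwise : ∀ j → j ≤ n → c j * (t ^ j * X j) ≡ + (n C j) * (sgn (n ℕ.∸ j) * (t ^ n * X j))
    termwise j j≤n = begin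
      (+ (n C j) * (- t) ^ (n ℕ.∸ j)) * (t ^ j * X j) ≡⟨ regroup (+ (n C j)) ((- t) ^ (n ℕ.∸ j)) (t ^ j) (X j) ⟩
      + (n C j) * ((- t) ^ (n ℕ.∸ j) * t ^ j * X j)   ≡⟨ cong (λ y → + (n C j) * (y * X j)) (neg-^-complement t j≤n) ⟩
      + (n C j) * (sgn (n ℕ.∸ j) * t ^ n * X j)       ≡⟨ cong (+ (n C j) *_) (ℤP.*-assoc (sgn (n ℕ.∸ j)) (t ^ n) (X j)) ⟩
      + (n C j) * (sgn (n ℕ.∸ j) * (t ^ n * X j))     ∎

  n!∣sum-R-dowling : ∀ n i t → i ≤ n → + (n !) ∣ sumℤ n (λ k → R m n k t * dowling (i ℕ.+ k) t)
  n!∣sum-R-dowling n i t i≤n = subst (+ (n !) ∣_) (sym (sum-R-dowling n i t i≤n))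
    (∣n⇒∣m*n (t ^ n) (∣-sumℤ i (λ p p≤i → ∣n⇒∣m*n (+ (i C p) * (+ m) ^ (i ℕ.∸ p) * dowling p t) (n!∣Δ-pow n (i ℕ.∸ p) (ℕP.≤-trans (ℕP.m∸n≤m i p) i≤n)))))

toℚᵘ-ι : ∀ z → ℚ.toℚᵘ (ι z) ℚᵘ.≃ mkℚᵘ z 0
toℚᵘ-ι z = ℚP.toℚᵘ-fromℚᵘ (mkℚᵘ z 0)

ι-+ : ∀ a b → ι (a + b) ≡ ι a ℚ.+ ι b
ι-+ a b = ℚP.toℚᵘ-injective (ℚᵘP.≃-trans (toℚᵘ-ι (a + b)) (ℚᵘP.≃-trans (*≡* (unit-denominators a b))
  (ℚᵘP.≃-sym (ℚᵘP.≃-trans (ℚP.toℚᵘ-homo-+ (ι a) (ι b)) (ℚᵘP.+-cong (toℚᵘ-ι a) (toℚᵘ-ι b))))))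
  where
  unit-denominators : ∀ a b → (a + b) * (+ 1 * + 1) ≡ (a * + 1 + b * + 1) * + 1
  unit-denominators = solve-∀

ι-* : ∀ a b → ι (a * b) ≡ ι a ℚ.* ι b
ι-* a b = ℚP.toℚᵘ-injective (ℚᵘP.≃-trans (toℚᵘ-ι (a * b)) (ℚᵘP.≃-trans (*≡* (unit-denominators a b))
  (ℚᵘP.≃-sym (ℚᵘP.≃-trans (ℚP.toℚᵘ-homo-* (ι a) (ι b)) (ℚᵘP.*-cong (toℚᵘ-ι a) (toℚᵘ-ι b))))))
  where
  unit-denominators : ∀ a b → (a * b) * (+ 1 * + 1) ≡ (a * b) * + 1
  unit-denominators = solve-∀

sumℚ-cong : ∀ n {f g : ℕ → ℚ} → (∀ i → f i ≡ g i) → sumℚ n f ≡ sumℚ n g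
sumℚ-cong zero    f≡g = f≡g 0
sumℚ-cong (suc n) f≡g = cong₂ ℚ._+_ (sumℚ-cong n f≡g) (f≡g (suc n))

sumℚ-ι : ∀ n (f : ℕ → ℤ) → sumℚ n (λ k → ι (f k)) ≡ ι (sumℤ n f)
sumℚ-ι zero    f = refl
sumℚ-ι (suc n) f = trans (cong (ℚ._+ ι (f (suc n))) (sumℚ-ι n f)) (sym (ι-+ (sumℤ n f) (f (suc n))))

/-exact : ∀ a z d .{{_ : NonZero d}} → a ≡ z * + d → a ℚ./ d ≡ ι z
/-exact a z (suc d) a≡zd = ℚP.fromℚᵘ-cong {mkℚᵘ a d} {mkℚᵘ z 0} (*≡* (trans (ℤP.*-identityʳ a) a≡zd))

module _ (m : ℕ) .{{_ : NonZero m}} where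

  W≡whitney₂ : ∀ N k → W m N k ≡ ι (whitney₂ m N k)
  W≡whitney₂ N k = /-exact _ (whitney₂ m N k) (m ℕ.^ k ℕ.* k !) {{ℕP.m*n≢0 (m ℕ.^ k) (k !) {{ℕP.m^n≢0 m k}} {{k ℕP.!≢0}}}}
    (trans (sum-cong k (λ i _ → ℤP.*-assoc (+ (k C i)) (sgn (k ℕ.∸ i)) _)) (Δ-dowling-power m N k))

  D≡dowling : ∀ N t → D m N t ≡ ι (dowling m N t)
  D≡dowling N t = begin
    sumℚ N (λ k → W m N k ℚ.* ι (t ^ k))                ≡⟨ sumℚ-cong N (λ k → cong (ℚ._* ι (t ^ k)) (W≡whitney₂ N k)) ⟩
    sumℚ N (λ k → ι (whitney₂ m N k) ℚ.* ι (t ^ k))      ≡⟨ sumℚ-cong N (λ k → sym (ι-* (whitney₂ m N k) (t ^ k))) ⟩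
    sumℚ N (λ k → ι (whitney₂ m N k * t ^ k))            ≡⟨ sumℚ-ι N (λ k → whitney₂ m N k * t ^ k) ⟩
    ι (dowling m N t)                                    ∎

mainTheorem15 : (m : ℕ) → .{{_ : NonZero m}} → (n i : ℕ) → i ≤ n → (t : ℤ) →
    ∃ λ (q : ℤ) → sumℚ n (λ k → ι (R m n k t) ℚ.* D m (i ℕ.+ k) t) ≡ ι (+ (n !) ℤ.* q)
mainTheorem15 m n i i≤n t = quotient n!∣S , (begin
  sumℚ n (λ k → ι (R m n k t) ℚ.* D m (i ℕ.+ k) t)
    ≡⟨ sumℚ-cong n (λ k → cong (ι (R m n k t) ℚ.*_) (D≡dowling m (i ℕ.+ k) t)) ⟩
  sumℚ n (λ k → ι (R m n k t) ℚ.* ι (dowling m (i ℕ.+ k) t))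
    ≡⟨ sumℚ-cong n (λ k → sym (ι-* (R m n k t) (dowling m (i ℕ.+ k) t))) ⟩
  sumℚ n (λ k → ι (f k))
    ≡⟨ sumℚ-ι n f ⟩
  ι (sumℤ n f)
    ≡⟨ cong ι (trans (_∣_.equality n!∣S) (ℤP.*-comm (quotient n!∣S) (+ (n !)))) ⟩
  ι (+ (n !) * quotient n!∣S) ∎)
  where
  f : ℕ → ℤ
  f k = R m n k t * dowling m (i ℕ.+ k) t
  n!∣S : + (n !) ∣ sumℤ n f
  n!∣S = n!∣sum-R-dowling m n i t i≤n
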